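{- Let $(P,\le_P)$ be a finite poset with antichains enumerated $S_1,\dots,S_m$ (including the empty antichain). The map $f_2$ (defined below) is an injection from $[m]^{[n]}_\star$ into the set of injective poset homomorphisms $P\to\mathcal{P}(n)$. Moreover, for each $\mathbf{A}\in[m]^{[n]}_\star$, $f_2(\mathbf{A})$ is an induced copy of $P$ in $\mathcal{P}(n)$, i.e. $f_2(\mathbf{A})(i)\subseteq f_2(\mathbf{A})(i')$ if and only if $i\le_P i'$.
   Context: $\mathcal{P}(n)$ is the power set of $[n]$ ordered by inclusion; a poset homomorphism $P\to\mathcal{P}(n)$ is a map $\phi$ with $x\le_Py\Rightarrow\phi(x)\subseteq\phi(y)$. $[m]^{[n]}_\star$ is the set of $m$-tuples $\mathbf{A}=(A_1,\dots,A_m)$ of pairwise disjoint nonempty subsets of $[n]$ whose union is $[n]$. For $i\in P$ let $D(i)=\{i'\in P: i'\le_P i\}$. Given $\mathbf{A}$, $f_2(\mathbf{A})$ is the map $\phi$ with $\phi(i)=\bigcup_{j:\,S_j\cap D(i)\ne\emptyset}A_j$. -}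

module Defs where

open import Level using (0ℓ)
open import Data.Nat using (ℕ)
open import Data.Fin using (Fin)
open import Data.Fin.Subset using (Subset; _∈_; _∩_; ⋃; ⊥; Nonempty; Empty)
open import Data.Fin.Subset.Properties using (nonempty?)
open import Data.List using (map)
open import Data.List.Base using (filter)
open import Data.List using (List)
open import Data.Fin.Base using ()
open import Data.Vec using (tabulate)
open import Data.Product using (Σ; ∃; _×_)
open import Relation.Nullary using (¬_; Dec)
open import Relation.Nullary.Decidable using (⌊_⌋)
open import Relation.Binary using (Rel; Decidable)
open import Relation.Binary.PropositionalEquality using (_≡_; _≢_)
import Data.List as L

allFin : (m : ℕ) → List (Fin m)
allFin m = L.allFin m

module _ {p : ℕ} (_≤_ : Rel (Fin p) 0ℓ) where

  IsAntichain : Subset p → Set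
  IsAntichain S = ∀ x y → x ∈ S → y ∈ S → x ≤ y → x ≡ y

  IsAntichainEnumeration : {m : ℕ} → (Fin m → Subset p) → Set
  IsAntichainEnumeration {m} S =
    (∀ j → IsAntichain (S j)) ×
    (∀ j j' → S j ≡ S j' → j ≡ j') ×
    (∀ T → IsAntichain T → ∃ λ j → S j ≡ T)

  IsPosetHom : {n : ℕ} → (Fin p → Subset n) → Set
  IsPosetHom φ = ∀ x y → x ≤ y → φ x Data.Fin.Subset.⊆ φ y

IsInjective : {p n : ℕ} → (Fin p → Subset n) → Set
IsInjective φ = ∀ x y → φ x ≡ φ y → x ≡ y

-- [m]^{[n]}_⋆ : m-tuples of pairwise disjoint nonempty subsets of [n] with union [n]
IsStar : {m n : ℕ} → (Fin m → Subset n) → Set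
IsStar {m} {n} A =
  (∀ j → Nonempty (A j)) ×
  (∀ j j' → j ≢ j' → Empty (A j ∩ A j')) ×
  (∀ k → ∃ λ j → k ∈ A j)

module _ {p : ℕ} {_≤_ : Rel (Fin p) 0ℓ} (_≤?_ : Decidable _≤_) where

  D : Fin p → Subset p
  D i = tabulate (λ i' → ⌊ i' ≤? i ⌋)

  f2 : {m n : ℕ} → (Fin m → Subset p) → (Fin m → Subset n) → Fin p → Subset n
  f2 {m} S' A i = ⋃ (map A (filter (λ j → nonempty? (S' j ∩ D i)) (allFin m)))

module Submission where

-- The map f₂ sends a partition A = (A₁,…,Aₘ) ∈ [m]^{[n]}_⋆ to
--   φ(i) = ⋃ { Aⱼ : Sⱼ meets the down-set D(i) }.
-- Since every k ∈ [n] lies in exactly one block A_j, membership in φ(i) is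
-- governed by a single antichain:  k ∈ φ(i)  ⇔  S_j meets D(i)  (k ∈ A_j).
-- Everything follows from this observation:
--   * monotonicity: "S meets D(i)" is upward closed in i;
--   * induced copy: choose j with S_j = {i} and k ∈ A_j; then k ∈ φ(i), so
--     φ(i) ⊆ φ(i') forces {i} to meet D(i'), i.e. i ≤ i'; injectivity of φ
--     follows by antisymmetry;
--   * injectivity of f₂: if f₂(A) = f₂(A') and k ∈ A_j ∩ A'_j', then S_j and
--     S_j' meet exactly the same down-sets, and an antichain is determined by
--     its up-closure, so j = j' by the uniqueness of the enumeration.

open import Defs
open import Level using (0ℓ)
open import Data.Nat using (ℕ)
open import Data.Fin using (Fin; _≟_)
open import Data.Fin.Subset using (Subset; _⊆_; _∈_; _∩_; ⋃; ⁅_⁆; Nonempty)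
open import Data.Fin.Subset.Properties
  using (x∈p∩q⁺; x∈p∩q⁻; x∈p∪q⁺; x∈p∪q⁻; ∉⊥; ⊆-antisym; x∈⁅x⁆; x∈⁅y⁆⇒x≡y; nonempty?)
open import Data.Bool using (Bool; true)
open import Data.Bool.Properties using (T-≡)
open import Data.List using (List; []; _∷_; map; filter)
import Data.List.Membership.Propositional as List
open import Data.List.Membership.Propositional.Properties
  using (∈-map⁻; ∈-map⁺; ∈-filter⁻; ∈-filter⁺; ∈-allFin)
open import Data.List.Relation.Unary.Any using (here; there)
open import Data.Product using (_×_; ∃; _,_; proj₁; proj₂)
open import Data.Sum using (inj₁; inj₂)
open import Data.Vec using (tabulate)
open import Data.Vec.Properties using (lookup∘tabulate; lookup⇒[]=; []=⇒lookup)
open import Data.Empty using (⊥-elim)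
open import Function using (_∘_)
open import Function.Bundles using (_⇔_; mk⇔; Equivalence)
import Function.Properties.Equivalence as ⇔
open import Relation.Nullary using (Dec; yes; no)
open import Relation.Nullary.Decidable using (toWitness; fromWitness)
open import Relation.Binary using (Rel; Decidable; IsPartialOrder; IsDecPartialOrder)
open import Relation.Binary.PropositionalEquality using (_≡_; refl; sym; trans; subst)

open Equivalence using (to; from)

∈⋃⁻ : ∀ {n} {x : Fin n} (ps : List (Subset n)) → x ∈ ⋃ ps → ∃ λ q → q List.∈ ps × x ∈ q
∈⋃⁻ []       x∈ = ⊥-elim (∉⊥ x∈)
∈⋃⁻ (p ∷ ps) x∈ with x∈p∪q⁻ p (⋃ ps) x∈
... | inj₁ x∈p  = p , here refl , x∈p
... | inj₂ x∈ps with ∈⋃⁻ ps x∈ps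
...   | q , q∈ps , x∈q = q , there q∈ps , x∈q

∈⋃⁺ : ∀ {n} {x : Fin n} {q} (ps : List (Subset n)) → q List.∈ ps → x ∈ q → x ∈ ⋃ ps
∈⋃⁺ (p ∷ ps) (here refl) x∈q = x∈p∪q⁺ (inj₁ x∈q)
∈⋃⁺ (p ∷ ps) (there q∈)  x∈q = x∈p∪q⁺ (inj₂ (∈⋃⁺ ps q∈ x∈q))

∈tabulate⇔ : ∀ {n} (f : Fin n → Bool) {x : Fin n} → x ∈ tabulate f ⇔ f x ≡ true
∈tabulate⇔ f {x} = mk⇔
  (λ x∈ → trans (sym (lookup∘tabulate f x)) ([]=⇒lookup x∈))
  (λ fx → lookup⇒[]= x _ (trans (lookup∘tabulate f x) fx))

module Antichains {p : ℕ} (_≤_ : Rel (Fin p) 0ℓ) where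

  _meets↓_ : Subset p → Fin p → Set
  T meets↓ i = ∃ λ x → x ∈ T × x ≤ i

  singleton-antichain : ∀ i → IsAntichain _≤_ ⁅ i ⁆
  singleton-antichain i x y x∈ y∈ _ = trans (x∈⁅y⁆⇒x≡y i x∈) (sym (x∈⁅y⁆⇒x≡y i y∈))

  singleton-meets↓ : ∀ {i i'} → ⁅ i ⁆ meets↓ i' → i ≤ i'
  singleton-meets↓ {i} (x , x∈ , x≤i') = subst (_≤ _) (x∈⁅y⁆⇒x≡y i x∈) x≤i'

  module _ (po : IsPartialOrder _≡_ _≤_) where
    open IsPartialOrder po using (antisym) renaming (refl to ≤-refl; trans to ≤-trans)

    meets↓-mono : ∀ {T i i'} → T meets↓ i → i ≤ i' → T meets↓ i'
    meets↓-mono (x , x∈T , x≤i) i≤i' = x , x∈T , ≤-trans x≤i i≤i'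

    meets↓-self : ∀ {T x} → x ∈ T → T meets↓ x
    meets↓-self {x = x} x∈T = x , x∈T , ≤-refl

    -- Half of "an antichain is determined by its up-closure": if every
    -- element x of T lies above some t ∈ T', which in turn lies above some
    -- s ∈ T, then s ≤ x forces s = x and hence t = x ∈ T'.
    antichain-⊆ : ∀ {T T'} → IsAntichain _≤_ T →
      (∀ i → T meets↓ i → T' meets↓ i) → (∀ i → T' meets↓ i → T meets↓ i) → T ⊆ T'
    antichain-⊆ {T} {T'} anti-T T⇒T' T'⇒T {x} x∈T
      with T⇒T' x (meets↓-self x∈T)
    ... | t , t∈T' , t≤x with T'⇒T t (meets↓-self t∈T')
    ...   | s , s∈T , s≤t with anti-T s x s∈T x∈T (≤-trans s≤t t≤x)
    ...     | refl = subst (_∈ T') (antisym t≤x s≤t) t∈T'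

    antichain-≡ : ∀ {T T'} → IsAntichain _≤_ T → IsAntichain _≤_ T' →
      (∀ i → T meets↓ i ⇔ T' meets↓ i) → T ≡ T'
    antichain-≡ anti-T anti-T' same = ⊆-antisym
      (antichain-⊆ anti-T  (to ∘ same) (from ∘ same))
      (antichain-⊆ anti-T' (from ∘ same) (to ∘ same))

block-unique : ∀ {m n} (A : Fin m → Subset n) → IsStar A →
  ∀ {k j j'} → k ∈ A j → k ∈ A j' → j ≡ j'
block-unique A (_ , disjoint , _) {k} {j} {j'} k∈Aj k∈Aj' with j ≟ j'
... | yes j≡j' = j≡j'
... | no  j≢j' = ⊥-elim (disjoint j j' j≢j' (k , x∈p∩q⁺ (k∈Aj , k∈Aj')))

module MembershipInF2 {p : ℕ} {_≤_ : Rel (Fin p) 0ℓ} (_≤?_ : Decidable _≤_)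
    {m : ℕ} (S : Fin m → Subset p) where
  open Antichains _≤_

  ∈D⇔ : ∀ {x i} → x ∈ D _≤?_ i ⇔ x ≤ i
  ∈D⇔ {x} {i} = mk⇔
    (λ x∈ → toWitness (from T-≡ (to (∈tabulate⇔ _) x∈)))
    (λ x≤i → from (∈tabulate⇔ _) (to T-≡ (fromWitness {a? = x ≤? i} x≤i)))

  nonempty⇔meets↓ : ∀ {j i} → Nonempty (S j ∩ D _≤?_ i) ⇔ S j meets↓ i
  nonempty⇔meets↓ {j} = mk⇔
    (λ { (x , x∈) → let x∈S , x∈D = x∈p∩q⁻ (S j) _ x∈ in x , x∈S , to ∈D⇔ x∈D })
    (λ { (x , x∈S , x≤i) → x , x∈p∩q⁺ (x∈S , from ∈D⇔ x≤i) })

  ∈f2⇔ : ∀ {n} (A : Fin m → Subset n) {k i} →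
    k ∈ f2 _≤?_ S A i ⇔ ∃ λ j → k ∈ A j × S j meets↓ i
  ∈f2⇔ A {k} {i} = mk⇔ ⇒ ⇐
    where
    condition : (j : Fin m) → Dec (Nonempty (S j ∩ D _≤?_ i))
    condition j = nonempty? (S j ∩ D _≤?_ i)

    relevant : List (Fin m)
    relevant = filter condition (allFin m)

    ⇒ : k ∈ f2 _≤?_ S A i → ∃ λ j → k ∈ A j × S j meets↓ i
    ⇒ k∈ with ∈⋃⁻ (map A relevant) k∈
    ... | q , q∈ , k∈q with ∈-map⁻ A q∈
    ...   | j , j∈ , refl =
      j , k∈q , to nonempty⇔meets↓ (proj₂ (∈-filter⁻ condition {xs = allFin m} j∈))

    ⇐ : (∃ λ j → k ∈ A j × S j meets↓ i) → k ∈ f2 _≤?_ S A i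
    ⇐ (j , k∈Aj , meets) =
      ∈⋃⁺ (map A relevant)
        (∈-map⁺ A (∈-filter⁺ condition (∈-allFin j) (from nonempty⇔meets↓ meets))) k∈Aj

  ∈f2-partition⇔ : ∀ {n} (A : Fin m → Subset n) → IsStar A →
    ∀ {k j i} → k ∈ A j → k ∈ f2 _≤?_ S A i ⇔ S j meets↓ i
  ∈f2-partition⇔ A star {k} {j} k∈Aj = mk⇔
    (λ k∈ → let j' , k∈Aj' , meets = to (∈f2⇔ A) k∈
            in subst (λ j'' → S j'' meets↓ _) (block-unique A star k∈Aj' k∈Aj) meets)
    (λ meets → from (∈f2⇔ A) (j , k∈Aj , meets))

module Theorem {p : ℕ} (_≤_ : Rel (Fin p) 0ℓ) (po : IsDecPartialOrder _≡_ _≤_)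
    {m : ℕ} (S : Fin m → Subset p) (enum : IsAntichainEnumeration _≤_ S) {n : ℕ} where
  open IsDecPartialOrder po using (_≤?_; antisym; isPartialOrder)
  open Antichains _≤_
  open MembershipInF2 _≤?_ S

  private
    φ : (Fin m → Subset n) → Fin p → Subset n
    φ = f2 _≤?_ S

  f2-hom : (A : Fin m → Subset n) → IsPosetHom _≤_ (φ A)
  f2-hom A i i' i≤i' k∈ =
    let j , k∈Aj , meets = to (∈f2⇔ A) k∈
    in from (∈f2⇔ A) (j , k∈Aj , meets↓-mono isPartialOrder meets i≤i')

  -- Reflection of order, via the block whose antichain is {i}.
  f2-reflects : (A : Fin m → Subset n) → IsStar A → ∀ i i' → φ A i ⊆ φ A i' → i ≤ i'
  f2-reflects A star@(nonempty , _ , _) i i' φi⊆φi' =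
    let j , Sj≡⁅i⁆ = proj₂ (proj₂ enum) ⁅ i ⁆ (singleton-antichain i)
        k , k∈Aj = nonempty j
        i∈Sj = subst (i ∈_) (sym Sj≡⁅i⁆) (x∈⁅x⁆ i)
        k∈φi = from (∈f2-partition⇔ A star k∈Aj) (meets↓-self isPartialOrder i∈Sj)
        Sj-meets-i' = to (∈f2-partition⇔ A star k∈Aj) (φi⊆φi' k∈φi)
    in singleton-meets↓ (subst (_meets↓ i') Sj≡⁅i⁆ Sj-meets-i')

  f2-induced : (A : Fin m → Subset n) → IsStar A → ∀ i i' → (φ A i ⊆ φ A i' ⇔ i ≤ i')
  f2-induced A star i i' = mk⇔ (f2-reflects A star i i') (f2-hom A i i')

  f2-injective : (A : Fin m → Subset n) → IsStar A → IsInjective (φ A)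
  f2-injective A star i i' φi≡φi' = antisym
    (f2-reflects A star i i' (subst (φ A i ⊆_) φi≡φi' (λ k∈ → k∈)))
    (f2-reflects A star i' i (subst (_⊆ φ A i) φi≡φi' (λ k∈ → k∈)))

  -- If f₂(A) = f₂(A'), a point k ∈ A_j lies in A'_j' with S_j and S_j'
  -- meeting the same down-sets, so S_j = S_j' and hence j = j'.
  f2-determines-blocks : ∀ A A' → IsStar A → IsStar A' →
    (∀ i → φ A i ≡ φ A' i) → ∀ j → A j ⊆ A' j
  f2-determines-blocks A A' star star' φ≡ j {k} k∈Aj =
    let j' , k∈A'j' = proj₂ (proj₂ star') k
        same-up-closure : ∀ i → S j meets↓ i ⇔ S j' meets↓ i
        same-up-closure i = ⇔.trans (⇔.sym (∈f2-partition⇔ A star k∈Aj))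
          (⇔.trans (subst (λ X → k ∈ φ A i ⇔ k ∈ X) (φ≡ i) ⇔.refl) (∈f2-partition⇔ A' star' k∈A'j'))
        Sj≡Sj' = antichain-≡ isPartialOrder (proj₁ enum j) (proj₁ enum j') same-up-closure
    in subst (λ j'' → k ∈ A' j'') (sym (proj₁ (proj₂ enum) j j' Sj≡Sj')) k∈A'j'

lemma2 : {p : ℕ} (_≤_ : Rel (Fin p) 0ℓ) (po : IsDecPartialOrder _≡_ _≤_)
    (m : ℕ) (S : Fin m → Subset p) → IsAntichainEnumeration _≤_ S →
    (n : ℕ) →
    ((A : Fin m → Subset n) → IsStar A →
      IsPosetHom _≤_ (f2 (IsDecPartialOrder._≤?_ po) S A)
      × IsInjective (f2 (IsDecPartialOrder._≤?_ po) S A))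
    × ((A A' : Fin m → Subset n) → IsStar A → IsStar A' →
      (∀ i → f2 (IsDecPartialOrder._≤?_ po) S A i ≡ f2 (IsDecPartialOrder._≤?_ po) S A' i) →
      ∀ j → A j ≡ A' j)
    × ((A : Fin m → Subset n) → IsStar A → ∀ i i' →
      (f2 (IsDecPartialOrder._≤?_ po) S A i ⊆ f2 (IsDecPartialOrder._≤?_ po) S A i' ⇔ i ≤ i'))
lemma2 _≤_ po m S enum n =
    (λ A star → f2-hom A , f2-injective A star)
  , (λ A A' star star' φ≡ j → ⊆-antisym
       (f2-determines-blocks A A' star star' φ≡ j)
       (f2-determines-blocks A' A star' star (sym ∘ φ≡) j))
  , f2-induced
  where open Theorem _≤_ po S enum {n}
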